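{- For every real $t$ and every integer $j$, as formal power series in $x$, $$\Lambda_j(t,x)=\Phi_{j+1}(t-1,x)+\Phi_{j+1}(t+1,x).$$
   Context: All series are formal power series in an indeterminate $x$ with real coefficients. For real $s$ and integer $m\ge 0$, $\binom{s}{m}=s(s-1)\cdots(s-m+1)/m!$. For real $s$ define $\Phi_0(s,x)=\sum_{k\ge1}\binom{s/2+k-1}{2k-1}x^{2k-1}$, $\Phi_1(s,x)=\sum_{k\ge0}\binom{(s-1)/2+k}{2k}x^{2k}$, $\Lambda_0(s,x)=\sum_{k\ge0}\binom{s/2+k}{2k}\frac{s}{s/2+k}x^{2k}$, $\Lambda_1(s,x)=\sum_{k\ge0}\binom{(s+1)/2+k}{2k+1}\frac{s}{(s+1)/2+k}x^{2k+1}$, where each coefficient is understood as the polynomial in $s$ it defines (the constant term of $\Lambda_0$ is $2$; for $k\ge1$ the coefficient of $x^{2k}$ in $\Lambda_0$ is $\frac{s}{2k}\binom{s/2+k-1}{2k-1}$; the coefficient of $x^{2k+1}$ in $\Lambda_1$ is $\frac{s}{2k+1}\binom{(s-1)/2+k}{2k}$). The index $j$ of $\Phi_j$ and $\Lambda_j$ is read modulo $2$, i.e. $\Phi_j:=\Phi_{j\bmod 2}$ and $\Lambda_j:=\Lambda_{j \bmod 2}$ for every integer $j$. -}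

module Defs where

open import Level using (Level; _⊔_) renaming (suc to lsuc)
open import Algebra.Bundles using (CommutativeRing)
open import Data.Nat using (ℕ; zero; suc; _%_; _/_) renaming (_+_ to _+ℕ_; _*_ to _*ℕ_)
open import Data.Integer using (ℤ; _%ℕ_)

module RingNat {c ℓ : Level} (R : CommutativeRing c ℓ) where
  open CommutativeRing R
  fromℕ : ℕ → Carrier
  fromℕ zero = 0#
  fromℕ (suc n) = 1# + fromℕ n

-- A commutative ring in which every positive integer is invertible
-- (a Q-algebra); the real numbers are such a ring.  `inv n` is 1/(n+1).
record QAlgebra (c ℓ : Level) : Set (lsuc (c ⊔ ℓ)) where
  field
    cring : CommutativeRing c ℓ
  open CommutativeRing cring
  open RingNat cring
  field
    inv : ℕ → Carrier
    inv-correct : ∀ n → fromℕ (suc n) * inv n ≈ 1#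

module Series {c ℓ : Level} (A : QAlgebra c ℓ) where
  open QAlgebra A
  open CommutativeRing cring public
  open RingNat cring public

  fall : Carrier → ℕ → Carrier
  fall s zero = 1#
  fall s (suc m) = fall s m * (s - fromℕ m)

  invFact : ℕ → Carrier
  invFact zero = 1#
  invFact (suc m) = invFact m * inv m

  binom : Carrier → ℕ → Carrier
  binom s m = fall s m * invFact m

  half : Carrier
  half = inv 1

  -- coefficient of x^n in Φ₀(s,x): for n = 2k-1 (k ≥ 1), binom(s/2+k-1, 2k-1)
  Φ₀ : Carrier → ℕ → Carrier
  Φ₀ s n with n % 2
  ... | zero = 0#
  ... | suc _ = binom (s * half + fromℕ (n / 2)) (suc (2 *ℕ (n / 2)))

  -- coefficient of x^n in Φ₁(s,x): for n = 2k, binom((s-1)/2+k, 2k)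
  Φ₁ : Carrier → ℕ → Carrier
  Φ₁ s n with n % 2
  ... | zero = binom ((s - 1#) * half + fromℕ (n / 2)) (2 *ℕ (n / 2))
  ... | suc _ = 0#

  -- coefficient of x^n in Λ₀(s,x): constant term 2; for n = 2k, k ≥ 1,
  -- (s/(2k)) binom(s/2+k-1, 2k-1)
  Λ₀ : Carrier → ℕ → Carrier
  Λ₀ s n with n % 2 | n / 2
  ... | zero | zero = fromℕ 2
  ... | zero | suc k = s * inv (suc (2 *ℕ k)) * binom (s * half + fromℕ k) (suc (2 *ℕ k))
  ... | suc _ | _ = 0#

  -- coefficient of x^n in Λ₁(s,x): for n = 2k+1, (s/(2k+1)) binom((s-1)/2+k, 2k)
  Λ₁ : Carrier → ℕ → Carrier
  Λ₁ s n with n % 2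
  ... | zero = 0#
  ... | suc _ = s * inv (2 *ℕ (n / 2)) * binom ((s - 1#) * half + fromℕ (n / 2)) (2 *ℕ (n / 2))

  Φ : ℤ → Carrier → ℕ → Carrier
  Φ j with j %ℕ 2
  ... | zero = Φ₀
  ... | suc _ = Φ₁

  Λ : ℤ → Carrier → ℕ → Carrier
  Λ j with j %ℕ 2
  ... | zero = Λ₀
  ... | suc _ = Λ₁

module Submission where

-- Λ_j and Φ_{j+1} are supported on exponents of the same parity, so for each parity of j
-- only one family of coefficients has to be compared.  With y and m chosen so that the two
-- Φ-coefficients are binom(y, m+1) and binom(y+1, m+1), the shift
-- fall(y+1, m+1) = (y+1) fall(y, m) gives
--   binom(y, m+1) + binom(y+1, m+1) = ((y - m) + (y + 1)) / (m+1) · binom(y, m),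
-- and for this choice of y one has (y - m) + (y + 1) = t, which is the Λ-coefficient.

open import Defs
open import Level using (Level)
open import Algebra.Bundles using (CommutativeRing)
open import Data.Nat using (ℕ; zero; suc; _%_; _/_) renaming (_+_ to _+ℕ_; _*_ to _*ℕ_)
open import Data.Integer using (ℤ; +_; -[1+_]; 1ℤ; _%ℕ_) renaming (_+_ to _+ℤ_)
import Data.Integer as ℤ
import Data.Integer.Properties as ℤ
import Data.Nat.Properties as ℕ
open import Data.Sign using (Sign) renaming (_*_ to _*ˢ_)
open import Data.Product using (_×_; _,_)
open import Data.Sum using (_⊎_; inj₁; inj₂)
open import Data.Maybe using (Maybe; just; nothing)
open import Relation.Nullary using (yes; no)
open import Relation.Binary.PropositionalEquality as ≡ using (_≡_; cong)
import Relation.Binary.Reasoning.Setoid as SetoidReasoning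

module IntegerCoefficients {c ℓ : Level} (R : CommutativeRing c ℓ) where
  open CommutativeRing R
  open SetoidReasoning setoid
  open import Algebra.Properties.Ring ring
    using (-0#≈0#; -‿involutive; -‿+-comm; -‿distribˡ-*; -‿distribʳ-*)
  open import Algebra.Properties.CommutativeSemigroup +-commutativeSemigroup using (interchange)
  open import Algebra.Properties.Semiring.Mult.TCOptimised semiring
    using (1+×; ×-homo-+; ×1-homo-*) renaming (_×_ to _×′_)
  import Algebra.Solver.Ring.AlmostCommutativeRing as ACR

  -- The optimised multiple `_×′_` makes ⟦ 1ℤ ⟧ reduce to 1#, so `:1` below denotes 1# itself.
  ⟦_⟧ : ℤ → Carrier
  ⟦ + n      ⟧ = n ×′ 1#
  ⟦ -[1+ n ] ⟧ = - (suc n ×′ 1#)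

  ⊖-homo : ∀ m n → ⟦ m ℤ.⊖ n ⟧ ≈ m ×′ 1# - n ×′ 1#
  ⊖-homo zero    zero    = sym (-‿inverseʳ 0#)
  ⊖-homo (suc m) zero    = sym (trans (+-congˡ -0#≈0#) (+-identityʳ _))
  ⊖-homo zero    (suc n) = sym (+-identityˡ _)
  ⊖-homo (suc m) (suc n) rewrite ℤ.[1+m]⊖[1+n]≡m⊖n m n = begin
    ⟦ m ℤ.⊖ n ⟧                   ≈⟨ ⊖-homo m n ⟩
    M - N                         ≈⟨ +-identityˡ _ ⟨
    0# + (M - N)                  ≈⟨ +-congʳ (-‿inverseʳ 1#) ⟨
    (1# - 1#) + (M - N)           ≈⟨ interchange 1# M (- 1#) (- N) ⟨
    (1# + M) + (- 1# - N)         ≈⟨ +-congˡ (-‿+-comm 1# N) ⟩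
    (1# + M) - (1# + N)           ≈⟨ +-cong (1+× m 1#) (-‿cong (1+× n 1#)) ⟨
    suc m ×′ 1# - suc n ×′ 1#     ∎
    where M = m ×′ 1#; N = n ×′ 1#

  +-homo : ∀ i j → ⟦ i ℤ.+ j ⟧ ≈ ⟦ i ⟧ + ⟦ j ⟧
  +-homo (+ m)    (+ n)    = ×-homo-+ 1# m n
  +-homo (+ m)    -[1+ n ] = ⊖-homo m (suc n)
  +-homo -[1+ m ] (+ n)    = trans (⊖-homo n (suc m)) (+-comm _ _)
  +-homo -[1+ m ] -[1+ n ] = begin
    - (suc (suc (m +ℕ n)) ×′ 1#)        ≡⟨ cong (λ k → - (suc k ×′ 1#)) (ℕ.+-suc m n) ⟨
    - ((suc m +ℕ suc n) ×′ 1#)          ≈⟨ -‿cong (×-homo-+ 1# (suc m) (suc n)) ⟩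
    - (suc m ×′ 1# + suc n ×′ 1#)       ≈⟨ -‿+-comm _ _ ⟨
    - (suc m ×′ 1#) + - (suc n ×′ 1#)   ∎

  -‿homo : ∀ i → ⟦ ℤ.- i ⟧ ≈ - ⟦ i ⟧
  -‿homo (+ zero)  = sym -0#≈0#
  -‿homo (+ suc n) = refl
  -‿homo -[1+ n ]  = sym (-‿involutive _)

  signed : Sign → Carrier → Carrier
  signed Sign.+ x = x
  signed Sign.- x = - x

  signed-cong : ∀ s {x y} → x ≈ y → signed s x ≈ signed s y
  signed-cong Sign.+ x≈y = x≈y
  signed-cong Sign.- x≈y = -‿cong x≈y

  signed-* : ∀ s s′ x y → signed (s *ˢ s′) (x * y) ≈ signed s x * signed s′ y
  signed-* Sign.+ Sign.+ x y = refl
  signed-* Sign.+ Sign.- x y = -‿distribʳ-* x y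
  signed-* Sign.- Sign.+ x y = -‿distribˡ-* x y
  signed-* Sign.- Sign.- x y = begin
    x * y             ≈⟨ -‿involutive _ ⟨
    - - (x * y)       ≈⟨ -‿cong (-‿distribʳ-* x y) ⟩
    - (x * - y)       ≈⟨ -‿distribˡ-* x (- y) ⟩
    - x * - y         ∎

  ⟦◃⟧ : ∀ s n → ⟦ s ℤ.◃ n ⟧ ≈ signed s (n ×′ 1#)
  ⟦◃⟧ Sign.+ zero    = refl
  ⟦◃⟧ Sign.+ (suc n) = refl
  ⟦◃⟧ Sign.- zero    = sym -0#≈0#
  ⟦◃⟧ Sign.- (suc n) = refl

  ⟦⟧≈signed : ∀ i → ⟦ i ⟧ ≈ signed (ℤ.sign i) (ℤ.∣ i ∣ ×′ 1#)
  ⟦⟧≈signed (+ n)    = refl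
  ⟦⟧≈signed -[1+ n ] = refl

  *-homo : ∀ i j → ⟦ i ℤ.* j ⟧ ≈ ⟦ i ⟧ * ⟦ j ⟧
  *-homo i j = begin
    ⟦ s ℤ.◃ ∣i∣ *ℕ ∣j∣ ⟧                         ≈⟨ ⟦◃⟧ s (∣i∣ *ℕ ∣j∣) ⟩
    signed s ((∣i∣ *ℕ ∣j∣) ×′ 1#)                   ≈⟨ signed-cong s (×1-homo-* ∣i∣ ∣j∣) ⟩
    signed s (∣i∣ ×′ 1# * ∣j∣ ×′ 1#)                 ≈⟨ signed-* (ℤ.sign i) (ℤ.sign j) _ _ ⟩
    signed (ℤ.sign i) (∣i∣ ×′ 1#) * signed (ℤ.sign j) (∣j∣ ×′ 1#) ≈⟨ *-cong (⟦⟧≈signed i) (⟦⟧≈signed j) ⟨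
    ⟦ i ⟧ * ⟦ j ⟧                                   ∎
    where s = ℤ.sign i *ˢ ℤ.sign j; ∣i∣ = ℤ.∣ i ∣; ∣j∣ = ℤ.∣ j ∣

  ℤ⟶R : ℤ.+-*-rawRing ACR.-Raw-AlmostCommutative⟶ ACR.fromCommutativeRing R
  ℤ⟶R = record
    { ⟦_⟧ = ⟦_⟧ ; +-homo = +-homo ; *-homo = *-homo ; -‿homo = -‿homo
    ; 0-homo = refl ; 1-homo = refl }

  ⟦⟧-≟ : ∀ i j → Maybe (⟦ i ⟧ ≈ ⟦ j ⟧)
  ⟦⟧-≟ i j with i ℤ.≟ j
  ... | yes ≡.refl = just refl
  ... | no  _      = nothing

  open import Algebra.Solver.Ring ℤ.+-*-rawRing (ACR.fromCommutativeRing R) ℤ⟶R ⟦⟧-≟ public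
    using (Polynomial; solve; _:=_; _:+_; _:*_; :-_; con)

  :1 : ∀ {n} → Polynomial n
  :1 = con 1ℤ

parity-negsuc : ∀ n → ((-[1+ n ] %ℕ 2 ≡ 0) × (-[1+ suc n ] %ℕ 2 ≡ 1))
                  ⊎ ((-[1+ n ] %ℕ 2 ≡ 1) × (-[1+ suc n ] %ℕ 2 ≡ 0))
parity-negsuc zero          = inj₂ (≡.refl , ≡.refl)
parity-negsuc (suc zero)    = inj₁ (≡.refl , ≡.refl)
parity-negsuc (suc (suc n)) = parity-negsuc n

parity-+1 : ∀ j → ((j %ℕ 2 ≡ 0) × ((j +ℤ 1ℤ) %ℕ 2 ≡ 1))
                 ⊎ ((j %ℕ 2 ≡ 1) × ((j +ℤ 1ℤ) %ℕ 2 ≡ 0))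
parity-+1 (+ zero)          = inj₁ (≡.refl , ≡.refl)
parity-+1 (+ suc zero)      = inj₂ (≡.refl , ≡.refl)
parity-+1 (+ suc (suc n))   = parity-+1 (+ n)
parity-+1 -[1+ zero ]       = inj₂ (≡.refl , ≡.refl)
parity-+1 -[1+ suc n ] rewrite ℤ.[1+m]⊖[1+n]≡m⊖n 0 (suc n) with parity-negsuc n
... | inj₁ (even , odd) = inj₂ (odd , even)
... | inj₂ (odd , even) = inj₁ (even , odd)

module _ {c ℓ : Level} (A : QAlgebra c ℓ) where
  open QAlgebra A using (inv; inv-correct; cring)
  open Series A
  open IntegerCoefficients cring
  open SetoidReasoning setoid

  fromℕ-+ : ∀ m n → fromℕ (m +ℕ n) ≈ fromℕ m + fromℕ n
  fromℕ-+ zero    n = sym (+-identityˡ _)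
  fromℕ-+ (suc m) n = trans (+-congˡ (fromℕ-+ m n)) (sym (+-assoc _ _ _))

  fromℕ-double : ∀ n → fromℕ (2 *ℕ n) ≈ fromℕ n + fromℕ n
  fromℕ-double n = trans (fromℕ-+ n (n +ℕ 0)) (+-congˡ (reflexive (cong fromℕ (ℕ.+-identityʳ n))))

  fall-cong : ∀ {x y} m → x ≈ y → fall x m ≈ fall y m
  fall-cong zero    _   = refl
  fall-cong (suc m) x≈y = *-cong (fall-cong m x≈y) (+-congʳ x≈y)

  binom-cong : ∀ {x y} m → x ≈ y → binom x m ≈ binom y m
  binom-cong m x≈y = *-congʳ (fall-cong m x≈y)

  fall-+1 : ∀ y m → fall (y + 1#) (suc m) ≈ (y + 1#) * fall y m
  fall-+1 y zero = solve 1 (λ y → :1 :* ((y :+ :1) :+ (:- con (+ 0))) := (y :+ :1) :* :1) refl y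
  fall-+1 y (suc m) = begin
    fall (y + 1#) (suc m) * ((y + 1#) - (1# + M))  ≈⟨ *-congʳ (fall-+1 y m) ⟩
    ((y + 1#) * fall y m) * ((y + 1#) - (1# + M))  ≈⟨ solve 3 (λ y f M →
        ((y :+ :1) :* f) :* ((y :+ :1) :+ (:- (:1 :+ M))) := (y :+ :1) :* (f :* (y :+ (:- M))))
        refl y (fall y m) M ⟩
    (y + 1#) * (fall y m * (y - M))                ∎
    where M = fromℕ m

  binom-suc : ∀ y m → binom y (suc m) ≈ binom y m * (y - fromℕ m) * inv m
  binom-suc y m = solve 4 (λ f d i j → (f :* d) :* (i :* j) := (f :* i) :* d :* j)
                          refl (fall y m) (y - fromℕ m) (invFact m) (inv m)

  binom-+1-suc : ∀ y m → binom (y + 1#) (suc m) ≈ (y + 1#) * binom y m * inv m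
  binom-+1-suc y m = begin
    fall (y + 1#) (suc m) * (invFact m * inv m)  ≈⟨ *-congʳ (fall-+1 y m) ⟩
    ((y + 1#) * fall y m) * (invFact m * inv m)  ≈⟨ solve 4 (λ a f i j → (a :* f) :* (i :* j) := a :* (f :* i) :* j)
                                                       refl (y + 1#) (fall y m) (invFact m) (inv m) ⟩
    (y + 1#) * binom y m * inv m                 ∎

  binom-suc+binom-+1-suc : ∀ y m →
    binom y (suc m) + binom (y + 1#) (suc m) ≈ ((y - fromℕ m) + (y + 1#)) * inv m * binom y m
  binom-suc+binom-+1-suc y m = begin
    binom y (suc m) + binom (y + 1#) (suc m)                      ≈⟨ +-cong (binom-suc y m) (binom-+1-suc y m) ⟩
    binom y m * (y - fromℕ m) * inv m + (y + 1#) * binom y m * inv m ≈⟨ solve 4 (λ B y M i →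
        B :* (y :+ (:- M)) :* i :+ (y :+ :1) :* B :* i := ((y :+ (:- M)) :+ (y :+ :1)) :* i :* B)
        refl (binom y m) y (fromℕ m) (inv m) ⟩
    ((y - fromℕ m) + (y + 1#)) * inv m * binom y m                ∎

  half+half≈1 : half + half ≈ 1#
  half+half≈1 = begin
    half + half                   ≈⟨ +-cong (*-identityˡ half) (*-identityˡ half) ⟨
    1# * half + 1# * half         ≈⟨ distribʳ half 1# 1# ⟨
    (1# + 1#) * half              ≈⟨ *-congʳ (+-congˡ (+-identityʳ 1#)) ⟨
    fromℕ 2 * half                ≈⟨ inv-correct 1 ⟩
    1#                            ∎

  -- The identities below hold only modulo 2·half = 1; the solver proves them in the shape
  -- x + c · (2·half - 1), and this lemma removes the defect.
  drop-halves-defect : ∀ x c → x + c * ((half + half) - 1#) ≈ x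
  drop-halves-defect x c = begin
    x + c * ((half + half) - 1#)  ≈⟨ +-congˡ (*-congˡ (+-congʳ half+half≈1)) ⟩
    x + c * (1# - 1#)             ≈⟨ +-congˡ (*-congˡ (-‿inverseʳ 1#)) ⟩
    x + c * 0#                    ≈⟨ +-congˡ (zeroʳ c) ⟩
    x + 0#                        ≈⟨ +-identityʳ x ⟩
    x                             ∎

  Λ₀≈Φ₁+Φ₁ : ∀ t n → Λ₀ t n ≈ Φ₁ (t - 1#) n + Φ₁ (t + 1#) n
  Λ₀≈Φ₁+Φ₁ t n with n % 2
  ... | suc _ = sym (+-identityˡ 0#)
  ... | zero with n / 2
  ...   | zero  = +-cong (sym (*-identityˡ 1#)) (trans (+-identityʳ 1#) (sym (*-identityˡ 1#)))
  ...   | suc k = begin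
    t * inv m * binom y m                         ≈⟨ *-congʳ (*-congʳ t≈) ⟩
    ((y - fromℕ m) + (y + 1#)) * inv m * binom y m ≈⟨ binom-suc+binom-+1-suc y m ⟨
    binom y (suc m) + binom (y + 1#) (suc m)       ≈⟨ +-cong (binom-cong (suc m) y₋≈) (binom-cong (suc m) y₊≈) ⟨
    binom y₋ (suc m) + binom y₊ (suc m)           ≡⟨ cong (λ i → binom y₋ i + binom y₊ i) (ℕ.*-suc 2 k) ⟨
    binom y₋ (2 *ℕ suc k) + binom y₊ (2 *ℕ suc k) ∎
    where
    m = suc (2 *ℕ k)
    K = fromℕ k
    y = t * half + K
    t≈ : t ≈ (y - fromℕ m) + (y + 1#)
    t≈ = sym (begin
      (y - (1# + fromℕ (2 *ℕ k))) + (y + 1#)  ≈⟨ +-congʳ (+-congˡ (-‿cong (+-congˡ (fromℕ-double k)))) ⟩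
      (y - (1# + (K + K))) + (y + 1#)         ≈⟨ solve 3 (λ t h K →
          ((t :* h :+ K) :+ (:- (:1 :+ (K :+ K)))) :+ ((t :* h :+ K) :+ :1) := t :+ t :* ((h :+ h) :+ (:- :1)))
          refl t half K ⟩
      t + t * ((half + half) - 1#)            ≈⟨ drop-halves-defect t t ⟩
      t                                       ∎)
    y₋ = ((t - 1#) - 1#) * half + fromℕ (suc k)
    y₊ = ((t + 1#) - 1#) * half + fromℕ (suc k)
    y₋≈ : y₋ ≈ y
    y₋≈ = trans (solve 3 (λ t h K →
            ((t :+ (:- :1)) :+ (:- :1)) :* h :+ (:1 :+ K) := (t :* h :+ K) :+ (:- :1) :* ((h :+ h) :+ (:- :1)))
            refl t half K)
         (drop-halves-defect y (- 1#))
    y₊≈ : y₊ ≈ y + 1#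
    y₊≈ = solve 3 (λ t h K → ((t :+ :1) :+ (:- :1)) :* h :+ (:1 :+ K) := (t :* h :+ K) :+ :1) refl t half K

  Λ₁≈Φ₀+Φ₀ : ∀ t n → Λ₁ t n ≈ Φ₀ (t - 1#) n + Φ₀ (t + 1#) n
  Λ₁≈Φ₀+Φ₀ t n with n % 2
  ... | zero  = sym (+-identityˡ 0#)
  ... | suc _ = begin
    t * inv m * binom y m                          ≈⟨ *-congʳ (*-congʳ t≈) ⟩
    ((y - fromℕ m) + (y + 1#)) * inv m * binom y m ≈⟨ binom-suc+binom-+1-suc y m ⟨
    binom y (suc m) + binom (y + 1#) (suc m)       ≈⟨ +-congˡ (binom-cong (suc m) y₊≈) ⟨
    binom y (suc m) + binom y₊ (suc m)             ∎
    where
    q = n / 2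
    m = 2 *ℕ q
    Q = fromℕ q
    y = (t - 1#) * half + Q
    y₊ = (t + 1#) * half + Q
    t≈ : t ≈ (y - fromℕ m) + (y + 1#)
    t≈ = sym (begin
      (y - fromℕ m) + (y + 1#)                ≈⟨ +-congʳ (+-congˡ (-‿cong (fromℕ-double q))) ⟩
      (y - (Q + Q)) + (y + 1#)                ≈⟨ solve 3 (λ t h Q →
          (((t :+ (:- :1)) :* h :+ Q) :+ (:- (Q :+ Q))) :+ (((t :+ (:- :1)) :* h :+ Q) :+ :1)
            := t :+ (t :+ (:- :1)) :* ((h :+ h) :+ (:- :1)))
          refl t half Q ⟩
      t + (t - 1#) * ((half + half) - 1#)     ≈⟨ drop-halves-defect t (t - 1#) ⟩
      t                                       ∎)
    y₊≈ : y₊ ≈ y + 1#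
    y₊≈ = trans (solve 3 (λ t h Q →
              (t :+ :1) :* h :+ Q := (((t :+ (:- :1)) :* h :+ Q) :+ :1) :+ :1 :* ((h :+ h) :+ (:- :1)))
              refl t half Q)
           (drop-halves-defect (y + 1#) 1#)

mainTheorem6 : ∀ {c ℓ : Level} (A : QAlgebra c ℓ) → let open Series A in
    ∀ (t : Carrier) (j : ℤ) (n : ℕ) →
    Λ j t n ≈ Φ (j +ℤ 1ℤ) (t - 1#) n + Φ (j +ℤ 1ℤ) (t + 1#) n
mainTheorem6 A t j n with j %ℕ 2 | (j +ℤ 1ℤ) %ℕ 2 | parity-+1 j
... | .0 | .1 | inj₁ (≡.refl , ≡.refl) = Λ₀≈Φ₁+Φ₁ A t n
... | .1 | .0 | inj₂ (≡.refl , ≡.refl) = Λ₁≈Φ₀+Φ₀ A t n
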